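{- If $q > p \geq 3$ are primes, then \[ \chi_a(\mathcal{U}(\mathbb{Z}_{pq})) \geq \frac{pq+1}{2}. \]
   Context: For a finite ring $R$ with unity and unit group $R^*$, the unitary addition Cayley graph $\mathcal{U}(R)$ is the simple graph with vertex set $R$ in which distinct vertices $x,y$ are adjacent if and only if $x+y \in R^*$; $\mathbb{Z}_n$ is the ring of integers modulo $n$. The achromatic number $\chi_a(G)$ of a graph $G$ is the maximum number of colors in a proper vertex coloring of $G$ such that for every pair of distinct color classes there is at least one edge of $G$ joining a vertex of one class to a vertex of the other. -}

module Defs where

open import Data.Nat using (ℕ; _+_; _*_; _≤_; NonZero)
open import Data.Nat.DivMod using (_mod_)
open import Data.Fin using (Fin; toℕ)
open import Data.Product using (Σ; ∃; ∃-syntax; _×_)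
open import Relation.Binary.PropositionalEquality using (_≡_; _≢_)

module ZMod (n : ℕ) .{{_ : NonZero n}} where

  _⊕_ : Fin n → Fin n → Fin n
  x ⊕ y = (toℕ x + toℕ y) mod n

  _⊗_ : Fin n → Fin n → Fin n
  x ⊗ y = (toℕ x * toℕ y) mod n

  one : Fin n
  one = 1 mod n

  IsUnit : Fin n → Set
  IsUnit x = ∃[ y ] (x ⊗ y ≡ one)

  UAdj : Fin n → Fin n → Set
  UAdj x y = (x ≢ y) × IsUnit (x ⊕ y)

record IsCompleteColoring {n k : ℕ} (Adj : Fin n → Fin n → Set)
                          (c : Fin n → Fin k) : Set where
  field
    surjective : ∀ (i : Fin k) → ∃[ x ] (c x ≡ i)
    proper     : ∀ x y → Adj x y → c x ≢ c y
    complete   : ∀ (i j : Fin k) → i ≢ j →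
                 ∃[ x ] ∃[ y ] (Adj x y × c x ≡ i × c y ≡ j)

AchromaticAtLeast : {n : ℕ} → (Fin n → Fin n → Set) → ℕ → Set
AchromaticAtLeast {n} Adj m =
  ∃[ k ] (m ≤ k × Σ (Fin n → Fin k) (IsCompleteColoring Adj))

{-# OPTIONS --safe #-}
module Submission where

-- Write p = 2P + 1 and q = 2Q + 1. By the Chinese remainder theorem a vertex x of 𝒰(ℤ_pq) is its
-- pair of residues (x mod p , x mod q), and x + y is a unit iff neither coordinate of the sum
-- vanishes; so it suffices to color this "sum graph" on ℤ_p × ℤ_q. Its vertices split into the
-- singleton (0,0) and (pq − 1)/2 pairs {c, c′} with c + c′ = 0 in one coordinate: (0,t) is paired
-- with (±P, −t), (s,t) with (−s, t+1) for 0 < s < P, and (P,t) with (P+1, t+Q+1) for t ≤ Q. Each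
-- of these (pq + 1)/2 classes is independent, and any two of them are joined by an edge: a vertex
-- whose first coordinate is neither −u nor −u′ is adjacent to (u,t) or to (u′,t+d) whenever
-- d ≠ 0, as the second coordinates of the two sums differ by d.

open import Defs
open import Data.Nat using (ℕ; _+_; _*_; _≤_; _<_; NonZero)
open import Data.Nat.DivMod using (_/_)
open import Data.Nat.Primality using (Prime)

open import Data.Bool using (if_then_else_; _∧_)
open import Data.Bool.Properties using (∧-zeroʳ)
open import Data.Fin using (Fin; toℕ; fromℕ<; combine; remQuot; punchOut)
open import Data.Fin.Properties
  using (toℕ-injective; toℕ-fromℕ<; toℕ<n; any?; injective⇒≤; punchOut-injective; remQuot-combine)
  renaming (_≟_ to _≟ᶠ_)
open import Data.Nat
open import Data.Nat.Coprimality using (Coprime; coprime-divisor; prime⇒coprime)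
import Data.Nat.Coprimality as Coprime
open import Data.Nat.Divisibility
open import Data.Nat.DivMod
open import Data.Nat.Primality
  using (euclidsLemma; prime⇒irreducible; prime⇒nonZero; prime⇒nonTrivial)
open import Data.Nat.Properties
open import Data.Nat.Tactic.RingSolver using (solve-∀)
open import Data.Product using (Σ; ∃-syntax; ∃₂; _×_; _,_; proj₁; proj₂; map₂)
open import Data.Sum using (_⊎_; inj₁; inj₂; [_,_]′)
open import Function using (_∘_)
open import Function.Definitions using (Injective)
open import Relation.Binary.Definitions using (tri<; tri≈; tri>)
open import Relation.Binary.PropositionalEquality
open import Relation.Nullary using (¬_; does; yes; no; contradiction)
open import Relation.Nullary.Decidable using (dec-true; dec-false)

module _ {d : ℕ} .{{_ : NonZero d}} where

  ∣-cong-% : ∀ {m n} → m % d ≡ n % d → d ∣ m → d ∣ n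
  ∣-cong-% {m} {n} eq d∣m = m%n≡0⇒n∣m n d (trans (sym eq) (n∣m⇒m%n≡0 m d d∣m))

  [m+n%d]%d≡[m+n]%d : ∀ m n → (m + n % d) % d ≡ (m + n) % d
  [m+n%d]%d≡[m+n]%d m n = begin
    (m + n % d) % d           ≡⟨ %-distribˡ-+ m (n % d) d ⟩
    (m % d + n % d % d) % d   ≡⟨ cong (λ x → (m % d + x) % d) (m%n%n≡m%n n d) ⟩
    (m % d + n % d) % d       ≡⟨ %-distribˡ-+ m n d ⟨
    (m + n) % d               ∎
    where open ≡-Reasoning

  %≡%⇒∣∸ : ∀ {m n} → m ≤ n → m % d ≡ n % d → d ∣ n ∸ m
  %≡%⇒∣∸ {m} {n} m≤n eq = divides (n / d ∸ m / d) (begin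
    n ∸ m                                       ≡⟨ cong₂ _∸_ (m≡m%n+[m/n]*n n d) (m≡m%n+[m/n]*n m d) ⟩
    (n % d + n / d * d) ∸ (m % d + m / d * d)   ≡⟨ cong (λ x → (n % d + n / d * d) ∸ (x + m / d * d)) eq ⟩
    (n % d + n / d * d) ∸ (n % d + m / d * d)   ≡⟨ [m+n]∸[m+o]≡n∸o (n % d) (n / d * d) (m / d * d) ⟩
    n / d * d ∸ m / d * d                       ≡⟨ *-distribʳ-∸ d (n / d) (m / d) ⟨
    (n / d ∸ m / d) * d                         ∎)
    where open ≡-Reasoning

  ∣∸⇒%≡% : ∀ {m n} → m ≤ n → d ∣ n ∸ m → m % d ≡ n % d
  ∣∸⇒%≡% {m} {n} m≤n d∣n∸m = begin
    m % d             ≡⟨ %-remove-+ʳ m d∣n∸m ⟨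
    (m + (n ∸ m)) % d ≡⟨ cong (_% d) (m+[n∸m]≡n m≤n) ⟩
    n % d             ∎
    where open ≡-Reasoning

  ∣+∸⇒≡ : ∀ {a b} → a < d → b < d → d ∣ a + (d ∸ b) → a ≡ b
  ∣+∸⇒≡ {a} {b} a<d b<d d∣ = sym (begin
    b             ≡⟨ m<n⇒m%n≡m b<d ⟨
    b % d         ≡⟨ ∣∸⇒%≡% b≤a+d (subst (d ∣_) (sym (+-∸-assoc a (<⇒≤ b<d))) d∣) ⟩
    (a + d) % d   ≡⟨ [m+n]%n≡m%n a d ⟩
    a % d         ≡⟨ m<n⇒m%n≡m a<d ⟩
    a             ∎)
    where
    open ≡-Reasoning
    b≤a+d : b ≤ a + d
    b≤a+d = ≤-trans (<⇒≤ b<d) (m≤n+m d a)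

  *-cancelˡ-% : ∀ {z a b} → Prime d → ¬ d ∣ z → (z * a) % d ≡ (z * b) % d → a % d ≡ b % d
  *-cancelˡ-% {z} {a} {b} prime-d d∤z eq =
    [ (λ a≤b → cancel a≤b eq) , (λ b≤a → sym (cancel b≤a (sym eq))) ]′ (≤-total a b)
    where
    cancel : ∀ {a b} → a ≤ b → (z * a) % d ≡ (z * b) % d → a % d ≡ b % d
    cancel {a} {b} a≤b eq with euclidsLemma z (b ∸ a) prime-d
      (subst (d ∣_) (sym (*-distribˡ-∸ z b a)) (%≡%⇒∣∸ (*-monoʳ-≤ z a≤b) eq))
    ... | inj₁ d∣z   = contradiction d∣z d∤z
    ... | inj₂ d∣b∸a = ∣∸⇒%≡% a≤b d∣b∸a

∣-<⇒≡0 : ∀ {d m} → d ∣ m → m < d → m ≡ 0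
∣-<⇒≡0 {m = zero}  _   _   = refl
∣-<⇒≡0 {m = suc _} d∣m m<d = contradiction d∣m (>⇒∤ m<d)

0<m<n⇒n∤m : ∀ {m n} → 0 < m → m < n → ¬ n ∣ m
0<m<n⇒n∤m 0<m m<n = >⇒∤ {{>-nonZero 0<m}} m<n

combine-injective : ∀ {m k} {i i′ : Fin m} {j j′ : Fin k} →
                    combine i j ≡ combine i′ j′ → (i , j) ≡ (i′ , j′)
combine-injective {i = i} {i′} {j} {j′} eq =
  trans (sym (remQuot-combine i j)) (trans (cong (remQuot _) eq) (remQuot-combine i′ j′))

injective⇒surjective : ∀ {m} {f : Fin m → Fin m} → Injective _≡_ _≡_ f → ∀ y → ∃[ x ] f x ≡ y
injective⇒surjective {zero}  _     ()
injective⇒surjective {suc m} {f} f-inj y with any? (λ x → f x ≟ᶠ y)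
... | yes hit = hit
... | no miss = contradiction (injective⇒≤ punchOut∘f-injective) (n≮n m)
  where
  y≢f : ∀ x → y ≢ f x
  y≢f x y≡fx = miss (x , sym y≡fx)
  punchOut∘f-injective : Injective _≡_ _≡_ (λ x → punchOut (y≢f x))
  punchOut∘f-injective eq = f-inj (punchOut-injective (y≢f _) (y≢f _) eq)

distinct-primes-coprime : ∀ {p q} → Prime p → Prime q → p ≢ q → Coprime p q
distinct-primes-coprime {p} {q} prime-p prime-q p≢q with <-cmp p q
... | tri< p<q _ _ = Coprime.sym (prime⇒coprime prime-q {{prime⇒nonZero prime-p}} p<q)
... | tri≈ _ p≡q _ = contradiction p≡q p≢q
... | tri> _ _ q<p = prime⇒coprime prime-p {{prime⇒nonZero prime-q}} q<p

module _ {p q : ℕ} .{{_ : NonZero p}} .{{_ : NonZero q}} (coprime : Coprime p q) where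

  coprime-∣⇒*∣ : ∀ {m} → p ∣ m → q ∣ m → p * q ∣ m
  coprime-∣⇒*∣ p∣m (divides c refl) =
    *-monoˡ-∣ q (coprime-divisor coprime (subst (p ∣_) (*-comm c q) p∣m))

  crt-injective : ∀ {x y} → x < p * q → y < p * q →
                  x % p ≡ y % p → x % q ≡ y % q → x ≡ y
  crt-injective {x} {y} x<pq y<pq eqp eqq =
    [ (λ x≤y → ≤-antisym x≤y (≤-flip x≤y y<pq eqp eqq))
    , (λ y≤x → ≤-antisym (≤-flip y≤x x<pq (sym eqp) (sym eqq)) y≤x) ]′ (≤-total x y)
    where
    ≤-flip : ∀ {x y} → x ≤ y → y < p * q → x % p ≡ y % p → x % q ≡ y % q → y ≤ x
    ≤-flip {x} {y} x≤y y<pq eqp eqq = m∸n≡0⇒m≤n (∣-<⇒≡0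
      (coprime-∣⇒*∣ (%≡%⇒∣∸ x≤y eqp) (%≡%⇒∣∸ x≤y eqq)) (≤-<-trans (m∸n≤m y x) y<pq))

prime≥3⇒odd : ∀ {p} → Prime p → 3 ≤ p → ∃[ P ] (0 < P × p ≡ suc (P + P))
prime≥3⇒odd {p} prime-p 3≤p = p / 2 , m≥n⇒m/n>0 (≤-trans (n≤1+n 2) 3≤p) , (begin
  p                  ≡⟨ m≡m%n+[m/n]*n p 2 ⟩
  p % 2 + p / 2 * 2  ≡⟨ cong₂ _+_ p%2≡1 (*-comm (p / 2) 2) ⟩
  1 + 2 * (p / 2)    ≡⟨ cong (λ x → suc (p / 2 + x)) (+-identityʳ (p / 2)) ⟩
  suc (p / 2 + p / 2) ∎)
  where
  open ≡-Reasoning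
  2∤p : ¬ 2 ∣ p
  2∤p 2∣p with prime⇒irreducible prime-p 2∣p
  ... | inj₂ refl = contradiction 3≤p λ { (s≤s (s≤s ())) }
  p%2≡1 : p % 2 ≡ 1
  p%2≡1 = ≤-antisym (s≤s⁻¹ (m%n<n p 2)) (n≢0⇒n>0 (2∤p ∘ m%n≡0⇒n∣m p 2))

module SumGraph (p q : ℕ) where

  Point : Set
  Point = ℕ × ℕ

  InRange : Point → Set
  InRange (s , t) = s < p × t < q

  record SumAdj (a b : Point) : Set where
    constructor sumAdj
    field
      p∤ : ¬ p ∣ proj₁ a + proj₁ b
      q∤ : ¬ q ∣ proj₂ a + proj₂ b

  SumAdj-sym : ∀ {a b} → SumAdj a b → SumAdj b a
  SumAdj-sym {s , t} {s′ , t′} (sumAdj p∤ q∤) =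
    sumAdj (p∤ ∘ subst (p ∣_) (+-comm s′ s)) (q∤ ∘ subst (q ∣_) (+-comm t′ t))

  -- Unlike UAdj, SumAdj allows loops, so `proper` concludes a ≡ b instead of assuming a ≢ b.
  record CompleteColoring (k : ℕ) : Set where
    field
      color      : Point → ℕ
      color-<    : ∀ {a} → InRange a → color a < k
      surjective : ∀ {i} → i < k → ∃[ a ] (InRange a × color a ≡ i)
      proper     : ∀ {a b} → InRange a → InRange b → SumAdj a b → color a ≡ color b → a ≡ b
      complete   : ∀ {i j} → i < k → j < k → i ≢ j →
                   ∃₂ λ a b → InRange a × InRange b × SumAdj a b × color a ≡ i × color b ≡ j

module PrimeProduct {p q : ℕ} (prime-p : Prime p) (prime-q : Prime q) (p≢q : p ≢ q) where

  instance
    p-nonTrivial : NonTrivial p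
    p-nonTrivial = prime⇒nonTrivial prime-p
    q-nonTrivial : NonTrivial q
    q-nonTrivial = prime⇒nonTrivial prime-q
    p≢0 : NonZero p
    p≢0 = prime⇒nonZero prime-p
    q≢0 : NonZero q
    q≢0 = prime⇒nonZero prime-q

  n : ℕ
  n = p * q

  instance
    n≢0 : NonZero n
    n≢0 = m*n≢0 p q

  open ZMod n
  open SumGraph p q

  coprime : Coprime p q
  coprime = distinct-primes-coprime prime-p prime-q p≢q

  p∣n : p ∣ n
  p∣n = m∣m*n q

  q∣n : q ∣ n
  q∣n = n∣m*n p

  1<n : 1 < n
  1<n = ≤-trans (nonTrivial⇒n>1 p) (m≤m*n p q)

  residues : Fin n → Point
  residues x = toℕ x % p , toℕ x % q

  residues-inRange : ∀ x → InRange (residues x)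
  residues-inRange x = m%n<n (toℕ x) p , m%n<n (toℕ x) q

  residues-injective : Injective _≡_ _≡_ residues
  residues-injective {x} {y} eq =
    toℕ-injective (crt-injective coprime (toℕ<n x) (toℕ<n y) (cong proj₁ eq) (cong proj₂ eq))

  encode : Fin n → Fin n
  encode x = combine (toℕ x mod p) (toℕ x mod q)

  encode-residues : ∀ {x} {i : Fin p} {j : Fin q} →
                    encode x ≡ combine i j → residues x ≡ (toℕ i , toℕ j)
  encode-residues eq = cong₂ _,_
    (trans (sym (toℕ-fromℕ< _)) (cong (toℕ ∘ proj₁) (combine-injective {p} {q} eq)))
    (trans (sym (toℕ-fromℕ< _)) (cong (toℕ ∘ proj₂) (combine-injective {p} {q} eq)))

  encode-injective : Injective _≡_ _≡_ encode
  encode-injective eq =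
    residues-injective (trans (encode-residues eq) (cong₂ _,_ (toℕ-fromℕ< _) (toℕ-fromℕ< _)))

  residues-surjective : ∀ {a} → InRange a → ∃[ x ] residues x ≡ a
  residues-surjective (s<p , t<q)
    with x , eq ← injective⇒surjective encode-injective (combine (fromℕ< s<p) (fromℕ< t<q))
    = x , trans (encode-residues eq) (cong₂ _,_ (toℕ-fromℕ< s<p) (toℕ-fromℕ< t<q))

  module _ {d : ℕ} .{{_ : NonZero d}} (d∣n : d ∣ n) where

    ⊗-residue : ∀ x y → toℕ (x ⊗ y) % d ≡ (toℕ x * toℕ y) % d
    ⊗-residue x y = trans (cong (_% d) (toℕ-fromℕ< _)) (m∣n⇒o%n%m≡o%m d n _ d∣n)

    ⊕-residue : ∀ x y → toℕ (x ⊕ y) % d ≡ (toℕ x % d + toℕ y % d) % d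
    ⊕-residue x y = trans (cong (_% d) (toℕ-fromℕ< _))
                          (trans (m∣n⇒o%n%m≡o%m d n _ d∣n) (%-distribˡ-+ (toℕ x) (toℕ y) d))

  isUnit⇒∤ : ∀ {d z} → d ∣ n → d ≢ 1 → IsUnit z → ¬ d ∣ toℕ z
  isUnit⇒∤ {d} {z} d∣n d≢1 (w , zw≡one) d∣z =
    d≢1 (∣1⇒≡1 (subst (d ∣_) zw≡1 (%-presˡ-∣ (∣m⇒∣m*n (toℕ w) d∣z) d∣n)))
    where
    zw≡1 : (toℕ z * toℕ w) % n ≡ 1
    zw≡1 = trans (sym (toℕ-fromℕ< _)) (trans (cong toℕ zw≡one) (trans (toℕ-fromℕ< _) (m<n⇒m%n≡m 1<n)))

  ⊗-cancelˡ : ∀ {z} → ¬ p ∣ toℕ z → ¬ q ∣ toℕ z → Injective _≡_ _≡_ (z ⊗_)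
  ⊗-cancelˡ {z} p∤z q∤z {a} {b} za≡zb =
    toℕ-injective (crt-injective coprime (toℕ<n a) (toℕ<n b)
                                 (cancel prime-p p∣n p∤z) (cancel prime-q q∣n q∤z))
    where
    cancel : ∀ {d} .{{_ : NonZero d}} → Prime d → d ∣ n → ¬ d ∣ toℕ z → toℕ a % d ≡ toℕ b % d
    cancel {d} prime-d d∣n d∤z = *-cancelˡ-% prime-d d∤z
      (trans (sym (⊗-residue d∣n z a)) (trans (cong (λ x → toℕ x % d) za≡zb) (⊗-residue d∣n z b)))

  ∤⇒isUnit : ∀ {z} → ¬ p ∣ toℕ z → ¬ q ∣ toℕ z → IsUnit z
  ∤⇒isUnit p∤z q∤z = injective⇒surjective (⊗-cancelˡ p∤z q∤z) one

  isUnit-⊕⇒SumAdj : ∀ {x y} → IsUnit (x ⊕ y) → SumAdj (residues x) (residues y)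
  isUnit-⊕⇒SumAdj {x} {y} unit = sumAdj
    (isUnit⇒∤ p∣n (nonTrivial⇒≢1 {p}) unit ∘ ∣-cong-% (sym (⊕-residue p∣n x y)))
    (isUnit⇒∤ q∣n (nonTrivial⇒≢1 {q}) unit ∘ ∣-cong-% (sym (⊕-residue q∣n x y)))

  SumAdj⇒isUnit-⊕ : ∀ {x y} → SumAdj (residues x) (residues y) → IsUnit (x ⊕ y)
  SumAdj⇒isUnit-⊕ {x} {y} (sumAdj p∤ q∤) =
    ∤⇒isUnit (p∤ ∘ ∣-cong-% (⊕-residue p∣n x y)) (q∤ ∘ ∣-cong-% (⊕-residue q∣n x y))

  CompleteColoring⇒IsCompleteColoring : ∀ {k} → CompleteColoring k →
                                        Σ (Fin n → Fin k) (IsCompleteColoring UAdj)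
  CompleteColoring⇒IsCompleteColoring {k} χ =
    color , record { surjective = surjective ; proper = proper ; complete = complete }
    where
    module χ = CompleteColoring χ

    color : Fin n → Fin k
    color x = fromℕ< (χ.color-< (residues-inRange x))

    toℕ-color : ∀ x → toℕ (color x) ≡ χ.color (residues x)
    toℕ-color x = toℕ-fromℕ< _

    realise : ∀ {a} {i : Fin k} → χ.color a ≡ toℕ i → ∃[ x ] residues x ≡ a →
              ∃[ x ] (residues x ≡ a × color x ≡ i)
    realise ca≡i (x , refl) = x , refl , toℕ-injective (trans (toℕ-color x) ca≡i)

    edge : ∀ {a b} {i j : Fin k} → i ≢ j → SumAdj a b →
             ∃[ x ] (residues x ≡ a × color x ≡ i) → ∃[ y ] (residues y ≡ b × color y ≡ j) →
             ∃[ x ] ∃[ y ] (UAdj x y × color x ≡ i × color y ≡ j)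
    edge i≢j adj (x , refl , cx≡i) (y , refl , cy≡j) =
      x , y , (x≢y , SumAdj⇒isUnit-⊕ adj) , cx≡i , cy≡j
      where
      x≢y : x ≢ y
      x≢y x≡y = i≢j (trans (sym cx≡i) (trans (cong color x≡y) cy≡j))

    surjective : ∀ i → ∃[ x ] color x ≡ i
    surjective i with (a , a∈ , ca≡i) ← χ.surjective (toℕ<n i) =
      map₂ proj₂ (realise ca≡i (residues-surjective a∈))

    proper : ∀ x y → UAdj x y → color x ≢ color y
    proper x y (x≢y , unit) cx≡cy = x≢y (residues-injective
      (χ.proper (residues-inRange x) (residues-inRange y) (isUnit-⊕⇒SumAdj unit)
                (trans (sym (toℕ-color x)) (trans (cong toℕ cx≡cy) (toℕ-color y)))))

    complete : ∀ i j → i ≢ j → ∃[ x ] ∃[ y ] (UAdj x y × color x ≡ i × color y ≡ j)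
    complete i j i≢j
      with (a , b , a∈ , b∈ , adj , ca≡i , cb≡j)
             ← χ.complete (toℕ<n i) (toℕ<n j) (i≢j ∘ toℕ-injective) =
      edge i≢j adj (realise ca≡i (residues-surjective a∈)) (realise cb≡j (residues-surjective b∈))

module OddSumGraph (P Q : ℕ) (0<P : 0 < P) (0<Q : 0 < Q) where

  p q k : ℕ
  p = suc (P + P)
  q = suc (Q + Q)
  k = suc (P * q + Q)

  open SumGraph p q

  P<p : P < p
  P<p = s≤s (m≤m+n P P)

  1+P<p : suc P < p
  1+P<p = s≤s (+-monoˡ-≤ P 0<P)

  Q<q : Q < q
  Q<q = s≤s (m≤m+n Q Q)

  1+Q<q : suc Q < q
  1+Q<q = s≤s (+-monoˡ-≤ Q 0<Q)

  p∤P : ¬ p ∣ P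
  p∤P = 0<m<n⇒n∤m 0<P P<p

  p∤1+P : ¬ p ∣ suc P
  p∤1+P = 0<m<n⇒n∤m z<s 1+P<p

  q∤1 : ¬ q ∣ 1
  q∤1 = 0<m<n⇒n∤m z<s (<-trans (s≤s 0<Q) 1+Q<q)

  q∤2 : ¬ q ∣ 2
  q∤2 = 0<m<n⇒n∤m z<s (≤-<-trans (s≤s 0<Q) 1+Q<q)

  Q<q∸t : ∀ {t} → t ≤ Q → Q < q ∸ t
  Q<q∸t t≤Q = ≤-trans (≤-reflexive (sym (m+n∸n≡m (suc Q) Q))) (∸-monoʳ-≤ q t≤Q)

  q∸t≤Q : ∀ {t} → Q < t → q ∸ t ≤ Q
  q∸t≤Q Q<t = ≤-trans (∸-monoʳ-≤ q Q<t) (≤-reflexive (m+n∸m≡n (suc Q) Q))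

  1+P<p∸s : ∀ {s} → s < P → suc P < p ∸ s
  1+P<p∸s {s} s<P = subst (_< p ∸ s) (m+n∸n≡m (suc P) P) (∸-monoʳ-< s<P (<⇒≤ P<p))

  <P⇒<p : ∀ {s} → s < P → s < p
  <P⇒<p s<P = <-trans s<P P<p

  rotate : ℕ → ℕ → ℕ
  rotate d t = (t + d) % q

  rotate-< : ∀ d t → rotate d t < q
  rotate-< d t = m%n<n (t + d) q

  rotate-inverse : ∀ {a b t} → a + b ≡ q → t < q → rotate b (rotate a t) ≡ t
  rotate-inverse {a} {b} {t} a+b≡q t<q = begin
    ((t + a) % q + b) % q   ≡⟨ cong (_% q) (+-comm _ b) ⟩
    (b + (t + a) % q) % q   ≡⟨ [m+n%d]%d≡[m+n]%d b (t + a) ⟩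
    (b + (t + a)) % q       ≡⟨ cong (_% q) (trans (+-comm b (t + a)) (+-assoc t a b)) ⟩
    (t + (a + b)) % q       ≡⟨ cong (λ x → (t + x) % q) a+b≡q ⟩
    (t + q) % q             ≡⟨ [m+n]%n≡m%n t q ⟩
    t % q                   ≡⟨ m<n⇒m%n≡m t<q ⟩
    t                       ∎
    where open ≡-Reasoning

  ∣-rotate : ∀ {x d t} → q ∣ x + rotate d t → q ∣ x + t + d
  ∣-rotate {x} {d} {t} =
    ∣-cong-% (trans ([m+n%d]%d≡[m+n]%d x (t + d)) (cong (_% q) (sym (+-assoc x t d))))

  index : Point → ℕ
  index (s , t) = s * q + t

  -- Representatives of the color classes: exactly the points (s , t) with t < q and s * q + t < k.
  data Rep : Point → Set where
    axis   : ∀ {t} → t < q → Rep (0 , t)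
    inner  : ∀ {s t} → 0 < s → s < P → t < q → Rep (s , t)
    middle : ∀ {t} → t ≤ Q → Rep (P , t)

  axisPartnerColumn : ℕ → ℕ
  axisPartnerColumn t with t ≤? Q
  ... | yes _ = P
  ... | no _  = suc P

  axisPartner : ℕ → Point
  axisPartner zero    = 0 , 0
  axisPartner (suc t) = axisPartnerColumn (suc t) , q ∸ suc t

  partner : ∀ {c} → Rep c → Point
  partner (axis {t} _)          = axisPartner t
  partner (inner {s} {t} _ _ _) = p ∸ s , rotate 1 t
  partner (middle {t} _)        = suc P , rotate (suc Q) t

  _∈[_] : ∀ {c} → Point → Rep c → Set
  _∈[_] {c} a r = a ≡ c ⊎ a ≡ partner r

  axisPartner-low : ∀ {t} → 0 < t → t ≤ Q → axisPartner t ≡ (P , q ∸ t)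
  axisPartner-low {suc t} _ t≤Q with suc t ≤? Q
  ... | yes _   = refl
  ... | no t≰Q = contradiction t≤Q t≰Q

  axisPartner-high : ∀ {t} → Q < t → axisPartner t ≡ (suc P , q ∸ t)
  axisPartner-high {suc t} Q<t with suc t ≤? Q
  ... | yes t≤Q = contradiction t≤Q (<⇒≱ Q<t)
  ... | no _    = refl

  ∈-inRange : ∀ {c a} (r : Rep c) → a ∈[ r ] → InRange a
  ∈-inRange (axis t<q)            (inj₁ refl) = z<s , t<q
  ∈-inRange (inner _ s<P t<q)     (inj₁ refl) = <P⇒<p s<P , t<q
  ∈-inRange (middle t≤Q)          (inj₁ refl) = P<p , ≤-<-trans t≤Q Q<q
  ∈-inRange (axis {zero} _)       (inj₂ refl) = z<s , z<s
  ∈-inRange (axis {suc t} t<q)    (inj₂ refl) with suc t ≤? Q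
  ... | yes _ = P<p , ∸-monoʳ-< z<s (<⇒≤ t<q)
  ... | no _  = 1+P<p , ∸-monoʳ-< z<s (<⇒≤ t<q)
  ∈-inRange (inner {t = t} 0<s s<P _) (inj₂ refl) = ∸-monoʳ-< 0<s (<⇒≤ (<P⇒<p s<P)) , rotate-< 1 t
  ∈-inRange (middle {t} _)        (inj₂ refl) = 1+P<p , rotate-< (suc Q) t

  Rep⇒inRange : ∀ {c} → Rep c → InRange c
  Rep⇒inRange r = ∈-inRange r (inj₁ refl)

  representative : Point → Point
  representative (s , t) =
    if does (s <? P) then (s , t)
    else if does (s ≟ P) then (if does (t ≤? Q) then (P , t) else (0 , q ∸ t))
    else if does (s ≟ suc P) then (if does (0 <? t) ∧ does (t ≤? Q) then (0 , q ∸ t) else (P , rotate Q t))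
    else (p ∸ s , rotate (Q + Q) t)

  representative-< : ∀ {s t} → s < P → representative (s , t) ≡ (s , t)
  representative-< {s} s<P rewrite dec-true (s <? P) s<P = refl

  representative-P-≤ : ∀ {t} → t ≤ Q → representative (P , t) ≡ (P , t)
  representative-P-≤ {t} t≤Q
    rewrite dec-false (P <? P) (n≮n P) | dec-true (P ≟ P) refl | dec-true (t ≤? Q) t≤Q = refl

  representative-P-> : ∀ {t} → Q < t → representative (P , t) ≡ (0 , q ∸ t)
  representative-P-> {t} Q<t
    rewrite dec-false (P <? P) (n≮n P) | dec-true (P ≟ P) refl | dec-false (t ≤? Q) (<⇒≱ Q<t) = refl

  representative-1+P-axis : ∀ {t} → 0 < t → t ≤ Q → representative (suc P , t) ≡ (0 , q ∸ t)
  representative-1+P-axis {t} 0<t t≤Q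
    rewrite dec-false (suc P <? P) (<-asym (n<1+n P)) | dec-false (suc P ≟ P) 1+n≢n
          | dec-true (suc P ≟ suc P) refl | dec-true (0 <? t) 0<t | dec-true (t ≤? Q) t≤Q
    = refl

  representative-1+P-middle : ∀ {t} → t ≡ 0 ⊎ Q < t → representative (suc P , t) ≡ (P , rotate Q t)
  representative-1+P-middle {t} t∉[1,Q]
    rewrite dec-false (suc P <? P) (<-asym (n<1+n P)) | dec-false (suc P ≟ P) 1+n≢n
          | dec-true (suc P ≟ suc P) refl
    with t∉[1,Q]
  ... | inj₁ refl = refl
  ... | inj₂ Q<t rewrite dec-false (t ≤? Q) (<⇒≱ Q<t) | ∧-zeroʳ (does (0 <? t)) = refl

  representative-> : ∀ {s t} → suc P < s → representative (s , t) ≡ (p ∸ s , rotate (Q + Q) t)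
  representative-> {s} 1+P<s
    rewrite dec-false (s <? P) (<-asym (<-trans (n<1+n P) 1+P<s))
          | dec-false (s ≟ P) (>⇒≢ (<-trans (n<1+n P) 1+P<s))
          | dec-false (s ≟ suc P) (>⇒≢ 1+P<s)
    = refl

  rotate-1+Q-Q : rotate (suc Q) Q ≡ 0
  rotate-1+Q-Q = trans (cong (_% q) (+-suc Q Q)) (n%n≡0 q)

  rotate-1+Q-outside : ∀ {t} → t ≤ Q → rotate (suc Q) t ≡ 0 ⊎ Q < rotate (suc Q) t
  rotate-1+Q-outside {t} t≤Q with m≤n⇒m<n∨m≡n t≤Q
  ... | inj₂ t≡Q = inj₁ (trans (cong (rotate (suc Q)) t≡Q) rotate-1+Q-Q)
  ... | inj₁ t<Q = inj₂ (subst (Q <_) (sym (m<n⇒m%n≡m t+1+Q<q)) (m≤n+m (suc Q) t))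
    where
    t+1+Q<q : t + suc Q < q
    t+1+Q<q = subst (t + suc Q <_) (+-suc Q Q) (+-monoˡ-< (suc Q) t<Q)

  representative-∈ : ∀ {c a} (r : Rep c) → a ∈[ r ] → representative a ≡ c
  representative-∈ (axis _)            (inj₁ refl) = representative-< 0<P
  representative-∈ (inner _ s<P _)     (inj₁ refl) = representative-< s<P
  representative-∈ (middle t≤Q)        (inj₁ refl) = representative-P-≤ t≤Q
  representative-∈ (axis {zero} _)     (inj₂ refl) = representative-< 0<P
  representative-∈ (axis {suc t} t<q)  (inj₂ refl) with suc t ≤? Q
  ... | yes t≤Q = trans (representative-P-> (Q<q∸t t≤Q)) (cong (0 ,_) (m∸[m∸n]≡n (<⇒≤ t<q)))
  ... | no t≰Q  = trans (representative-1+P-axis (m<n⇒0<n∸m t<q) (q∸t≤Q (≰⇒> t≰Q)))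
                        (cong (0 ,_) (m∸[m∸n]≡n (<⇒≤ t<q)))
  representative-∈ (inner _ s<P t<q)   (inj₂ refl) =
    trans (representative-> (1+P<p∸s s<P))
          (cong₂ _,_ (m∸[m∸n]≡n (<⇒≤ (<P⇒<p s<P))) (rotate-inverse refl t<q))
  representative-∈ (middle t≤Q)        (inj₂ refl) =
    trans (representative-1+P-middle (rotate-1+Q-outside t≤Q))
          (cong (P ,_) (rotate-inverse refl (≤-<-trans t≤Q Q<q)))

  Classified : Point → Set
  Classified a = ∃₂ λ c (r : Rep c) → a ∈[ r ]

  Rep-< : ∀ {s t} → s < P → t < q → Rep (s , t)
  Rep-< {zero}  _   t<q = axis t<q
  Rep-< {suc _} s<P t<q = inner z<s s<P t<q

  classify-P : ∀ {t} → t < q → Classified (P , t)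
  classify-P {t} t<q with t ≤? Q
  ... | yes t≤Q = _ , middle t≤Q , inj₁ refl
  ... | no t≰Q = _ , axis (∸-monoʳ-< (≤-<-trans z≤n Q<t) (<⇒≤ t<q)) , inj₂ (sym (begin
    axisPartner (q ∸ t)  ≡⟨ axisPartner-low (m<n⇒0<n∸m t<q) (q∸t≤Q Q<t) ⟩
    P , q ∸ (q ∸ t)      ≡⟨ cong (P ,_) (m∸[m∸n]≡n (<⇒≤ t<q)) ⟩
    P , t                ∎))
    where
    open ≡-Reasoning
    Q<t : Q < t
    Q<t = ≰⇒> t≰Q

  classify-1+P : ∀ {t} → t < q → Classified (suc P , t)
  classify-1+P {zero} _ = _ , middle ≤-refl , inj₂ (cong (suc P ,_) (sym rotate-1+Q-Q))
  classify-1+P {suc t} t<q with suc t ≤? Q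
  ... | yes t≤Q = _ , axis (∸-monoʳ-< z<s (<⇒≤ t<q)) , inj₂ (sym (begin
    axisPartner (q ∸ suc t)  ≡⟨ axisPartner-high (Q<q∸t t≤Q) ⟩
    suc P , q ∸ (q ∸ suc t)  ≡⟨ cong (suc P ,_) (m∸[m∸n]≡n (<⇒≤ t<q)) ⟩
    suc P , suc t            ∎))
    where open ≡-Reasoning
  ... | no t≰Q = _ , middle t∸Q≤Q , inj₂ (cong (suc P ,_) (sym (begin
    (t ∸ Q + suc Q) % q  ≡⟨ cong (_% q) (trans (+-suc (t ∸ Q) Q) (cong suc (m∸n+n≡m Q≤t))) ⟩
    suc t % q            ≡⟨ m<n⇒m%n≡m t<q ⟩
    suc t                ∎)))
    where
    open ≡-Reasoning
    Q≤t : Q ≤ t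
    Q≤t = s≤s⁻¹ (≰⇒> t≰Q)
    t∸Q≤Q : t ∸ Q ≤ Q
    t∸Q≤Q = ≤-trans (∸-monoˡ-≤ Q (s≤s⁻¹ (<⇒≤ t<q))) (≤-reflexive (m+n∸n≡m Q Q))

  classify-> : ∀ {s t} → suc P < s → s < p → t < q → Classified (s , t)
  classify-> {s} {t} 1+P<s s<p t<q =
    _ , inner (m<n⇒0<n∸m s<p) p∸s<P (rotate-< (Q + Q) t) ,
    inj₂ (sym (cong₂ _,_ (m∸[m∸n]≡n (<⇒≤ s<p)) (rotate-inverse (+-comm (Q + Q) 1) t<q)))
    where
    p∸s<P : p ∸ s < P
    p∸s<P = subst (p ∸ s <_) (m+n∸m≡n (suc P) P) (∸-monoʳ-< 1+P<s (<⇒≤ s<p))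

  classify : ∀ {a} → InRange a → Classified a
  classify {s , t} (s<p , t<q) with <-cmp s P
  ... | tri< s<P _ _ = _ , Rep-< s<P t<q , inj₁ refl
  ... | tri≈ _ refl _ = classify-P t<q
  ... | tri> _ _ P<s with m≤n⇒m<n∨m≡n P<s
  ...   | inj₁ 1+P<s = classify-> 1+P<s s<p t<q
  ...   | inj₂ refl  = classify-1+P t<q

  Rep-irrelevant : ∀ {c} (r r′ : Rep c) → r ≡ r′
  Rep-irrelevant (axis h)          (axis h′)            = cong axis (<-irrelevant h h′)
  Rep-irrelevant (axis _)          (middle _)           = contradiction 0<P λ ()
  Rep-irrelevant (inner a b c)     (inner a′ b′ c′)
    rewrite <-irrelevant a a′ | <-irrelevant b b′ | <-irrelevant c c′ = refl
  Rep-irrelevant (inner _ s<P _)   (middle _)           = contradiction s<P (n≮n _)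
  Rep-irrelevant (middle _)        (axis _)             = contradiction 0<P λ ()
  Rep-irrelevant (middle _)        (inner _ s<P _)      = contradiction s<P (n≮n _)
  Rep-irrelevant (middle h)        (middle h′)          = cong middle (≤-irrelevant h h′)

  index-% : ∀ {s t} → t < q → index (s , t) % q ≡ t
  index-% {s} {t} t<q = trans (cong (_% q) (+-comm (s * q) t)) (trans ([m+kn]%n≡m%n t s q) (m<n⇒m%n≡m t<q))

  index-injective : ∀ {s t s′ t′} → t < q → t′ < q →
                    index (s , t) ≡ index (s′ , t′) → (s , t) ≡ (s′ , t′)
  index-injective {s} {t} {s′} {t′} t<q t′<q eq = cong₂ _,_ s≡s′ t≡t′
    where
    t≡t′ : t ≡ t′
    t≡t′ = trans (sym (index-% {s} t<q)) (trans (cong (_% q) eq) (index-% {s′} t′<q))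
    s≡s′ : s ≡ s′
    s≡s′ = *-cancelʳ-≡ s s′ q
             (+-cancelʳ-≡ t (s * q) (s′ * q) (trans eq (cong (s′ * q +_) (sym t≡t′))))

  index-/% : ∀ i → index (i / q , i % q) ≡ i
  index-/% i = trans (+-comm (i / q * q) (i % q)) (sym (m≡m%n+[m/n]*n i q))

  index-< : ∀ {s t} → s < P → t < q → index (s , t) < P * q
  index-< {s} {t} s<P t<q = begin-strict
    s * q + t   <⟨ +-monoʳ-< (s * q) t<q ⟩
    s * q + q   ≡⟨ +-comm (s * q) q ⟩
    suc s * q   ≤⟨ *-monoˡ-≤ q s<P ⟩
    P * q       ∎
    where open ≤-Reasoning

  Rep⇒index<k : ∀ {c} → Rep c → index c < k
  Rep⇒index<k (axis t<q)        = <-≤-trans (index-< 0<P t<q) (m≤n⇒m≤1+n (m≤m+n (P * q) Q))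
  Rep⇒index<k (inner _ s<P t<q) = <-≤-trans (index-< s<P t<q) (m≤n⇒m≤1+n (m≤m+n (P * q) Q))
  Rep⇒index<k (middle t≤Q)      = s≤s (+-monoʳ-≤ (P * q) t≤Q)

  index<k⇒Rep : ∀ {s t} → t < q → index (s , t) < k → Rep (s , t)
  index<k⇒Rep {s} {t} t<q st<k with <-cmp s P
  ... | tri< s<P _ _ = Rep-< s<P t<q
  ... | tri≈ _ refl _ = middle (+-cancelˡ-≤ (P * q) t Q (s≤s⁻¹ st<k))
  ... | tri> _ _ P<s = contradiction st<k (≤⇒≯ (begin
    suc (P * q + Q)  ≡⟨ +-suc (P * q) Q ⟨
    P * q + suc Q    ≤⟨ +-monoʳ-≤ (P * q) Q<q ⟩
    P * q + q        ≡⟨ +-comm (P * q) q ⟩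
    suc P * q        ≤⟨ *-monoˡ-≤ q P<s ⟩
    s * q            ≤⟨ m≤m+n (s * q) t ⟩
    s * q + t        ∎))
    where open ≤-Reasoning

  /%-injective : ∀ {i j} → (i / q , i % q) ≡ (j / q , j % q) → i ≡ j
  /%-injective {i} {j} eq = trans (sym (index-/% i)) (trans (cong index eq) (index-/% j))

  decode : ∀ {i} → i < k → Rep (i / q , i % q)
  decode {i} i<k = index<k⇒Rep (m%n<n i q) (subst (_< k) (sym (index-/% i)) i<k)

  partner-¬adjacent : ∀ {c} (r : Rep c) → ¬ SumAdj c (partner r)
  partner-¬adjacent (axis {zero} _)     (sumAdj p∤ _) = p∤ (p ∣0)
  partner-¬adjacent (axis {suc t} t<q)  (sumAdj _ q∤) =
    q∤ (subst (q ∣_) (sym (m+[n∸m]≡n (<⇒≤ t<q))) ∣-refl)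
  partner-¬adjacent (inner _ s<P _)     (sumAdj p∤ _) =
    p∤ (subst (p ∣_) (sym (m+[n∸m]≡n (<⇒≤ (<P⇒<p s<P)))) ∣-refl)
  partner-¬adjacent (middle _)          (sumAdj p∤ _) = p∤ (subst (p ∣_) (sym (+-suc P P)) ∣-refl)

  ∈-same-class : ∀ {c a b} (r : Rep c) → a ∈[ r ] → b ∈[ r ] → SumAdj a b → a ≡ b
  ∈-same-class r (inj₁ refl) (inj₁ refl) _   = refl
  ∈-same-class r (inj₁ refl) (inj₂ refl) adj = contradiction adj (partner-¬adjacent r)
  ∈-same-class r (inj₂ refl) (inj₁ refl) adj = contradiction (SumAdj-sym adj) (partner-¬adjacent r)
  ∈-same-class r (inj₂ refl) (inj₂ refl) _   = refl

  record Joined {c c′} (r : Rep c) (r′ : Rep c′) : Set where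
    constructor joinedBy
    field
      {a b} : Point
      a∈r   : a ∈[ r ]
      b∈r′  : b ∈[ r′ ]
      a~b   : SumAdj a b

  Joined-sym : ∀ {c c′} {r : Rep c} {r′ : Rep c′} → Joined r r′ → Joined r′ r
  Joined-sym (joinedBy a∈r b∈r′ a~b) = joinedBy b∈r′ a∈r (SumAdj-sym a~b)

  adjacent-to-rotated-pair : ∀ {x y u u′ d t} → ¬ q ∣ d → ¬ p ∣ x + u → ¬ p ∣ x + u′ →
                             SumAdj (x , y) (u , t) ⊎ SumAdj (x , y) (u′ , rotate d t)
  adjacent-to-rotated-pair {y = y} {d = d} {t = t} q∤d p∤x+u p∤x+u′ with q ∣? y + t
  ... | no q∤y+t  = inj₁ (sumAdj p∤x+u q∤y+t)
  ... | yes q∣y+t =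
    inj₂ (sumAdj p∤x+u′ λ q∣ → q∤d (∣m+n∣m⇒∣n (∣-rotate {y} {d} {t} q∣) q∣y+t))

  joined-rotated : ∀ {c a u u′ t′ d} {r : Rep c} (r′ : Rep (u , t′)) →
                   partner r′ ≡ (u′ , rotate d t′) → ¬ q ∣ d →
                   a ∈[ r ] → ¬ p ∣ proj₁ a + u → ¬ p ∣ proj₁ a + u′ → Joined r r′
  joined-rotated {a = x , y} {u} {u′} {t′} r′ partner≡ q∤d a∈r p∤ p∤′
    with adjacent-to-rotated-pair {x} {y} {u} {u′} {t = t′} q∤d p∤ p∤′
  ... | inj₁ a~b = joinedBy a∈r (inj₁ refl) a~b
  ... | inj₂ a~b = joinedBy a∈r (inj₂ (sym partner≡)) a~b

  joined-inner : ∀ {c a u t′} {r : Rep c} (0<u : 0 < u) (u<P : u < P) (t′<q : t′ < q) →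
                 a ∈[ r ] → ¬ p ∣ proj₁ a + u → ¬ p ∣ proj₁ a + (p ∸ u) →
                 Joined r (inner 0<u u<P t′<q)
  joined-inner 0<u u<P t′<q = joined-rotated (inner 0<u u<P t′<q) refl q∤1

  joined-middle : ∀ {c a t′} {r : Rep c} (t′≤Q : t′ ≤ Q) →
                  a ∈[ r ] → ¬ p ∣ proj₁ a + P → ¬ p ∣ proj₁ a + suc P → Joined r (middle t′≤Q)
  joined-middle t′≤Q = joined-rotated (middle t′≤Q) refl q∤1+Q
    where
    q∤1+Q : ¬ q ∣ suc Q
    q∤1+Q = 0<m<n⇒n∤m z<s 1+Q<q

  axis-adjacent : ∀ {z t} → z < q → suc t < q → z ≢ suc t → SumAdj (0 , z) (axisPartner (suc t))
  axis-adjacent {z} {t} z<q t<q z≢ with suc t ≤? Q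
  ... | yes _ = sumAdj p∤P   (z≢ ∘ ∣+∸⇒≡ z<q t<q)
  ... | no _  = sumAdj p∤1+P (z≢ ∘ ∣+∸⇒≡ z<q t<q)

  joined-axis : ∀ {z z′} (z<q : z < q) (z′<q : z′ < q) → z ≢ z′ → Joined (axis z<q) (axis z′<q)
  joined-axis {zero}  {zero}  _   _   z≢z′ = contradiction refl z≢z′
  joined-axis {z}     {suc _} z<q t<q z≢z′ =
    joinedBy (inj₁ refl) (inj₂ refl) (axis-adjacent z<q t<q z≢z′)
  joined-axis {suc _} {zero}  t<q _   _    =
    joinedBy (inj₂ refl) (inj₁ refl) (SumAdj-sym (axis-adjacent z<s t<q λ ()))

  joined-inner-inner : ∀ {u v t t′} (0<u : 0 < u) (u<P : u < P) (t<q : t < q)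
                       (0<v : 0 < v) (v<P : v < P) (t′<q : t′ < q) →
                       Joined (inner 0<u u<P t<q) (inner 0<v v<P t′<q)
  joined-inner-inner {u} {v} {t} {t′} 0<u u<P t<q 0<v v<P t′<q with u ≟ v
  ... | no u≢v = joined-inner 0<v v<P t′<q (inj₁ refl)
                   (0<m<n⇒n∤m (≤-trans 0<u (m≤m+n u v)) (<-trans (+-mono-< u<P v<P) (n<1+n (P + P))))
                   (u≢v ∘ ∣+∸⇒≡ (<P⇒<p u<P) (<P⇒<p v<P))
  -- If t + t′ ≡ 0 (mod q), the second coordinates of the partners sum to t + t′ + 2.
  ... | yes refl with q ∣? t + t′
  ...   | no q∤t+t′  = joinedBy (inj₁ refl) (inj₁ refl) (sumAdj p∤u+u q∤t+t′)
    where
    p∤u+u : ¬ p ∣ u + u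
    p∤u+u = 0<m<n⇒n∤m (≤-trans 0<u (m≤m+n u u)) (<-trans (+-mono-< u<P u<P) (n<1+n (P + P)))
  ...   | yes q∣t+t′ = joinedBy (inj₂ refl) (inj₂ refl) (sumAdj p∤[p∸u]+[p∸u] q∤rotated)
    where
    p∸u≢u : p ∸ u ≢ u
    p∸u≢u e = <⇒≢ (<-trans (<-trans u<P (n<1+n P)) (1+P<p∸s u<P)) (sym e)
    p∤[p∸u]+[p∸u] : ¬ p ∣ (p ∸ u) + (p ∸ u)
    p∤[p∸u]+[p∸u] = p∸u≢u ∘ ∣+∸⇒≡ (∸-monoʳ-< 0<u (<⇒≤ (<P⇒<p u<P))) (<P⇒<p u<P)
    shift : ∀ t t′ → t + 1 + (t′ + 1) ≡ t + t′ + 2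
    shift = solve-∀
    q∤rotated : ¬ q ∣ rotate 1 t + rotate 1 t′
    q∤rotated q∣ = q∤2 (∣m+n∣m⇒∣n
      (subst (q ∣_) (shift t t′) (∣-cong-% (sym (%-distribˡ-+ (t + 1) (t′ + 1) q)) q∣)) q∣t+t′)

  joined : ∀ {c c′} (r : Rep c) (r′ : Rep c′) → c ≢ c′ → Joined r r′
  joined (axis z<q) (axis z′<q) c≢c′ = joined-axis z<q z′<q (c≢c′ ∘ cong (0 ,_))
  joined (axis _) (inner 0<u u<P t′<q) _ =
    joined-inner 0<u u<P t′<q (inj₁ refl)
      (0<m<n⇒n∤m 0<u (<P⇒<p u<P)) (<⇒≢ 0<u ∘ ∣+∸⇒≡ z<s (<P⇒<p u<P))
  joined (axis _) (middle t′≤Q) _ = joined-middle t′≤Q (inj₁ refl) p∤P p∤1+P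
  joined (inner 0<u u<P t<q) (inner 0<v v<P t′<q) _ = joined-inner-inner 0<u u<P t<q 0<v v<P t′<q
  joined (middle t≤Q) (inner {u} 0<u u<P t′<q) _ =
    joined-inner 0<u u<P t′<q (inj₁ refl)
      (0<m<n⇒n∤m (≤-trans 0<P (m≤m+n P u)) (<-trans (+-monoʳ-< P u<P) (n<1+n (P + P))))
      ((<⇒≢ u<P ∘ sym) ∘ ∣+∸⇒≡ P<p (<P⇒<p u<P))
  joined (middle {t} t≤Q) (middle {t′} t′≤Q) c≢c′ =
    joinedBy (inj₁ refl) (inj₁ refl)
      (sumAdj (0<m<n⇒n∤m (≤-trans 0<P (m≤m+n P P)) (n<1+n (P + P)))
              (0<m<n⇒n∤m (0<t+t′ t≢t′) (s≤s (+-mono-≤ t≤Q t′≤Q))))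
    where
    t≢t′ : t ≢ t′
    t≢t′ = c≢c′ ∘ cong (P ,_)
    0<t+t′ : ∀ {t t′} → t ≢ t′ → 0 < t + t′
    0<t+t′ {zero}  t≢t′ = n≢0⇒n>0 (t≢t′ ∘ sym)
    0<t+t′ {suc _} _    = z<s
  joined r@(inner _ _ _) r′@(axis _)  c≢c′ = Joined-sym (joined r′ r (c≢c′ ∘ sym))
  joined r@(inner _ _ _) r′@(middle _) c≢c′ = Joined-sym (joined r′ r (c≢c′ ∘ sym))
  joined r@(middle _)    r′@(axis _)  c≢c′ = Joined-sym (joined r′ r (c≢c′ ∘ sym))

  color : Point → ℕ
  color = index ∘ representative

  color-∈ : ∀ {c a} (r : Rep c) → a ∈[ r ] → color a ≡ index c
  color-∈ r a∈r = cong index (representative-∈ r a∈r)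

  Rep-index-injective : ∀ {c c′} → Rep c → Rep c′ → index c ≡ index c′ → c ≡ c′
  Rep-index-injective r r′ = index-injective (proj₂ (Rep⇒inRange r)) (proj₂ (Rep⇒inRange r′))

  classes-proper : ∀ {a b} → Classified a → Classified b → SumAdj a b → color a ≡ color b → a ≡ b
  classes-proper (_ , r , a∈r) (_ , r′ , b∈r′) adj ca≡cb
    with refl ← Rep-index-injective r r′
                  (trans (sym (color-∈ r a∈r)) (trans ca≡cb (color-∈ r′ b∈r′)))
    with refl ← Rep-irrelevant r r′
    = ∈-same-class r a∈r b∈r′ adj

  completeColoring : CompleteColoring k
  completeColoring = record
    { color      = color
    ; color-<    = color-<
    ; surjective = surjective
    ; proper     = proper
    ; complete   = complete
    }
    where
    color-< : ∀ {a} → InRange a → color a < k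
    color-< a∈ with _ , r , a∈r ← classify a∈ = subst (_< k) (sym (color-∈ r a∈r)) (Rep⇒index<k r)

    surjective : ∀ {i} → i < k → ∃[ a ] (InRange a × color a ≡ i)
    surjective {i} i<k = _ , Rep⇒inRange (decode i<k) , trans (color-∈ (decode i<k) (inj₁ refl)) (index-/% i)

    proper : ∀ {a b} → InRange a → InRange b → SumAdj a b → color a ≡ color b → a ≡ b
    proper a∈ b∈ = classes-proper (classify a∈) (classify b∈)

    complete : ∀ {i j} → i < k → j < k → i ≢ j →
               ∃₂ λ a b → InRange a × InRange b × SumAdj a b × color a ≡ i × color b ≡ j
    complete i<k j<k i≢j =
      edge (decode i<k) (decode j<k) (joined (decode i<k) (decode j<k) (i≢j ∘ /%-injective))
      where
      edge : ∀ {i j} (r : Rep (i / q , i % q)) (r′ : Rep (j / q , j % q)) → Joined r r′ →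
             ∃₂ λ a b → InRange a × InRange b × SumAdj a b × color a ≡ i × color b ≡ j
      edge {i} {j} r r′ (joinedBy {a} {b} a∈r b∈r′ adj) =
        a , b , ∈-inRange r a∈r , ∈-inRange r′ b∈r′ , adj ,
        trans (color-∈ r a∈r) (index-/% i) , trans (color-∈ r′ b∈r′) (index-/% j)

  [pq+1]/2≡k : (p * q + 1) / 2 ≡ k
  [pq+1]/2≡k = trans (cong (_/ 2) (double P Q)) (m*n/n≡m k 2)
    where
    double : ∀ P Q → suc (P + P) * suc (Q + Q) + 1 ≡ suc (P * suc (Q + Q) + Q) * 2
    double = solve-∀

theorem2 : ∀ (p q : ℕ) → Prime p → Prime q → 3 ≤ p → p < q →
    .{{_ : NonZero (p * q)}} →
    AchromaticAtLeast (ZMod.UAdj (p * q)) ((p * q + 1) / 2)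
theorem2 p q prime-p prime-q 3≤p p<q
  with P , 0<P , refl ← prime≥3⇒odd prime-p 3≤p
  with Q , 0<Q , refl ← prime≥3⇒odd prime-q (≤-trans 3≤p (<⇒≤ p<q))
  = let open OddSumGraph P Q 0<P 0<Q in
    k , ≤-reflexive [pq+1]/2≡k ,
    PrimeProduct.CompleteColoring⇒IsCompleteColoring prime-p prime-q (<⇒≢ p<q) completeColoring
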